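{- For a positive integer $j$ define $\mu(j)=\min\{k\ge 2j-1:\ (2j-1)!\,(2j-1)\mid k!\}$, and for integers $k\ge 2j-1$ define $a_{k,j}=\frac{2\cdot k!}{(2j-1)!\,(2j-1)}$. Then: (a) $\mu(j)\le 4j-2$, with equality if and only if $2j-1$ is a prime number. (b) For $k\ge 2j-1$, $a_{k,j}$ is an integer if and only if $k\ge\mu(j)$. (c) Suppose $2j-1=\prod_{p\mid 2j-1}p^{e_p}$ with all exponents satisfying $e_p\le p$. Then $\mu(j)=2j-1+\max\{e_p p:\ p\mid 2j-1\}$ (with the maximum over the empty set taken to be $0$).
   Context: $p$ runs over primes. -}

module Defs where

open import Data.Nat using (ℕ; zero; suc; _+_; _*_; _∸_; _^_; _≤_; _<_; _!)
open import Data.Nat.Divisibility using (_∣_)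
open import Data.Nat.Primality using (Prime)

open import Data.Product using (_×_; ∃-syntax)
open import Data.Sum using (_⊎_)
open import Relation.Nullary using (¬_)
open import Relation.Binary.PropositionalEquality using (_≡_)

odd : ℕ → ℕ
odd j = 2 * j ∸ 1

D : ℕ → ℕ
D j = (odd j) ! * odd j

IsMu : ℕ → ℕ → Set
IsMu j m = odd j ≤ m × D j ∣ m ! × (∀ k → odd j ≤ k → k < m → ¬ (D j ∣ k !))

AIsInteger : ℕ → ℕ → Set
AIsInteger k j = D j ∣ 2 * k !

IsValuation : ℕ → ℕ → ℕ → Set
IsValuation p n e = p ^ e ∣ n × ¬ (p ^ suc e ∣ n)

-- M = max { e_p * p : p prime, p ∣ n }, with max ∅ = 0
IsMaxEpP : ℕ → ℕ → Set
IsMaxEpP n M =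
  (∀ p e → Prime p → p ∣ n → IsValuation p n e → e * p ≤ M)
  × (M ≡ 0 ⊎ ∃[ p ] ∃[ e ] (Prime p × p ∣ n × IsValuation p n e × M ≡ e * p))

module Submission where

-- Write n = 2j-1.  Splitting (n+L)! = n!·(n+1)⋯(n+L), whose second factor is
-- congruent to L! modulo n, gives  n!·n ∣ c·(n+L)!  ⇔  n ∣ c·L!  for every c.
-- Hence μ(j) = n + S(n), where S(n) is the least L with n ∣ L! (the Kempner
-- function), and as n is odd the factor 2 in a_{k,j} is irrelevant: part (b).
-- Parts (a) and (c) become statements about S(n):
--   (a) S(n) ≤ n as n ∣ n!; a prime n divides no L! with L < n; an odd
--       non-prime n divides (n-1)!, since each prime power q^a ∣ n has
--       a·q ≤ n-1 and q^a ∣ (a·q)!.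
--   (c) for a prime p and L < p² the exponent t of p in L! has t·p ≤ L, so
--       p^e ∤ L! when e ≤ p and L < e·p; conversely each q^a ∣ n divides M!.

open import Defs
open import Data.Nat
open import Data.Nat.Properties
open import Data.Nat.Divisibility
open import Data.Nat.Primality
open import Data.Nat.Primality.Factorisation using (PrimeFactorisation; factorise)
open import Data.Nat.Coprimality using (Coprime; coprime-divisor) renaming (sym to coprime-sym)
open import Data.Nat.Induction using (<-wellFounded)
open import Data.Nat.Tactic.RingSolver using (solve-∀)
open import Induction.WellFounded using (Acc; acc)
open import Data.List using ([]; _∷_)
open import Data.List.Relation.Unary.All using (_∷_)
open import Data.Product using (_×_; _,_; proj₁; proj₂; ∃-syntax)
open import Data.Sum using (_⊎_; inj₁; inj₂)
open import Relation.Nullary using (¬_; Dec; yes; no; contradiction)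
open import Relation.Binary.PropositionalEquality
open import Function.Bundles using (_⇔_; mk⇔; Equivalence)
open import Function.Properties.Equivalence using () renaming (trans to ⇔-trans)

least-below : {P : ℕ → Set} → (∀ k → Dec (P k)) → ∀ b →
  ∃[ s ] (P s × (∀ k → P k → s ≤ k)) ⊎ (∀ k → k < b → ¬ P k)
least-below P? zero = inj₂ (λ k ())
least-below P? (suc b) with least-below P? b
... | inj₁ found = inj₁ found
... | inj₂ none with P? b
...   | yes pb = inj₁ (b , pb , λ k pk → ≮⇒≥ (λ k<b → none k k<b pk))
...   | no ¬pb = inj₂ extend
  where
  extend : ∀ k → k < suc b → ¬ _
  extend k k<1+b with m<1+n⇒m<n∨m≡n k<1+b
  ... | inj₁ k<b = none k k<b
  ... | inj₂ refl = ¬pb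

least : {P : ℕ → Set} → (∀ k → Dec (P k)) → ∀ {b} → P b →
  ∃[ s ] (P s × (∀ k → P k → s ≤ k))
least P? {b} pb with least-below P? (suc b)
... | inj₁ found = found
... | inj₂ none = contradiction pb (none b ≤-refl)

∣-mod : ∀ {n a b} c → a ≡ b + n * c → (n ∣ a ⇔ n ∣ b)
∣-mod {n} {a} {b} c a≡b+nc = mk⇔
  (λ n∣a → ∣m+n∣m⇒∣n (subst (n ∣_) (trans a≡b+nc (+-comm b (n * c))) n∣a) (m∣m*n c))
  (λ n∣b → subst (n ∣_) (sym a≡b+nc) (∣m∣n⇒∣m+n n∣b (m∣m*n c)))

rising : ℕ → ℕ → ℕ
rising n zero    = 1
rising n (suc L) = (n + suc L) * rising n L

factorial-split : ∀ n L → (n + L) ! ≡ n ! * rising n L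
factorial-split n zero = trans (cong _! (+-identityʳ n)) (sym (*-identityʳ (n !)))
factorial-split n (suc L) = begin
  (n + suc L) !                        ≡⟨ cong _! (+-suc n L) ⟩
  suc (n + L) * (n + L) !              ≡⟨ cong (suc (n + L) *_) (factorial-split n L) ⟩
  suc (n + L) * (n ! * rising n L)     ≡⟨ reorder (n + L) (n !) (rising n L) ⟩
  n ! * (suc (n + L) * rising n L)     ≡⟨ cong (λ x → n ! * (x * rising n L)) (sym (+-suc n L)) ⟩
  n ! * rising n (suc L)               ∎
  where
  open ≡-Reasoning
  reorder : ∀ x y z → suc x * (y * z) ≡ y * (suc x * z)
  reorder = solve-∀

-- Modulo n, every factor n+i of the rising product is congruent to i, so
-- (n+1)⋯(n+L) ≡ L!.
rising-congruent : ∀ n L → ∃[ c ] rising n L ≡ L ! + n * c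
rising-congruent n zero = 0 , cong suc (sym (*-zeroʳ n))
rising-congruent n (suc L) with rising-congruent n L
... | c , eq = L ! + c * (n + suc L) , trans (cong ((n + suc L) *_) eq) (expand n L (L !) c)
  where
  expand : ∀ n L f c → (n + suc L) * (f + n * c) ≡ suc L * f + n * (f + c * (n + suc L))
  expand = solve-∀

reduction : ∀ c n L → (n ! * n ∣ c * (n + L) !) ⇔ (n ∣ c * L !)
reduction c n L = ⇔-trans cancel-n! (∣-mod (c * r) scaled)
  where
  instance _ = n !≢0
  r = proj₁ (rising-congruent n L)
  regroup : c * (n + L) ! ≡ n ! * (c * rising n L)
  regroup = trans (cong (c *_) (factorial-split n L)) (swap c (n !) (rising n L))
    where swap : ∀ x y z → x * (y * z) ≡ y * (x * z)
          swap = solve-∀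
  cancel-n! : (n ! * n ∣ c * (n + L) !) ⇔ (n ∣ c * rising n L)
  cancel-n! = mk⇔
    (λ h → *-cancelˡ-∣ (n !) (subst (n ! * n ∣_) regroup h))
    (λ h → subst (n ! * n ∣_) (sym regroup) (*-monoʳ-∣ (n !) h))
  scaled : c * rising n L ≡ c * L ! + n * (c * r)
  scaled = trans (cong (c *_) (proj₂ (rising-congruent n L))) (distribute c (L !) n r)
    where distribute : ∀ c f n r → c * (f + n * r) ≡ c * f + n * (c * r)
          distribute = solve-∀

reduction₁ : ∀ n L → (n ! * n ∣ (n + L) !) ⇔ (n ∣ L !)
reduction₁ n L = subst₂ (λ x y → (n ! * n ∣ x) ⇔ (n ∣ y))
  (*-identityˡ ((n + L) !)) (*-identityˡ (L !)) (reduction 1 n L)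

prime-coprime : ∀ {p r} → Prime p → ¬ p ∣ r → Coprime p r
prime-coprime pr ¬p∣r (d∣p , d∣r) with prime⇒irreducible pr d∣p
... | inj₁ d≡1 = d≡1
... | inj₂ refl = contradiction d∣r ¬p∣r

odd-cancel : ∀ {n x} → ¬ 2 ∣ n → n ∣ 2 * x → n ∣ x
odd-cancel ¬2∣n = coprime-divisor (coprime-sym (prime-coprime prime[2] ¬2∣n))

prime-∤-* : ∀ {p a b} → Prime p → ¬ p ∣ a → ¬ p ∣ b → ¬ p ∣ a * b
prime-∤-* {a = a} {b} pr ¬p∣a ¬p∣b p∣ab with euclidsLemma a b pr p∣ab
... | inj₁ p∣a = ¬p∣a p∣a
... | inj₂ p∣b = ¬p∣b p∣b

prime≥2 : ∀ {p} → Prime p → 2 ≤ p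
prime≥2 {p} pr = nonTrivial⇒n>1 p {{prime⇒nonTrivial pr}}

¬prime-∣1 : ∀ {p} → Prime p → ¬ p ∣ 1
¬prime-∣1 pr p∣1 = ¬prime[1] (subst Prime (∣1⇒≡1 p∣1) pr)

^-∣-^ : ∀ p {b a} → b ≤ a → p ^ b ∣ p ^ a
^-∣-^ p {zero}  _         = 1∣ _
^-∣-^ p {suc b} (s≤s b≤a) = *-monoʳ-∣ p (^-∣-^ p b≤a)

pow-∤ : ∀ {p t r e} → Prime p → ¬ p ∣ r → t < e → ¬ p ^ e ∣ p ^ t * r
pow-∤ {p} {t} {r} {e} pr ¬p∣r t<e p^e∣ = ¬p∣r (*-cancelˡ-∣ (p ^ t) p^t*p∣p^t*r)
  where
  instance _ = m^n≢0 p t {{prime⇒nonZero pr}}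
  p^t*p∣p^t*r : p ^ t * p ∣ p ^ t * r
  p^t*p∣p^t*r = ∣-trans (subst (_∣ p ^ e) (*-comm p (p ^ t)) (^-∣-^ p t<e)) p^e∣

-- q^a ∣ (a·q)!, since the factors q, 2q, …, aq all occur in (a·q)!.
pow-∣-factorial : ∀ q .{{_ : NonZero q}} a → q ^ a ∣ (a * q) !
pow-∣-factorial q zero = 1∣ 1
pow-∣-factorial q@(suc _) (suc a) =
  subst (q ^ suc a ∣_) split (*-pres-∣ q∣rising (pow-∣-factorial q a))
  where
  q∣rising : q ∣ rising (a * q) q
  q∣rising = ∣m⇒∣m*n _ (∣m∣n⇒∣m+n (n∣m*n a) ∣-refl)
  split : rising (a * q) q * (a * q) ! ≡ (suc a * q) !
  split = trans (*-comm _ ((a * q) !))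
                (trans (sym (factorial-split (a * q) q)) (cong _! (+-comm (a * q) q)))

-- For a prime p and L < p², write L! = p^t·r with p ∤ r; then t·p ≤ L,
-- because each multiple s·p ≤ L has s < p and so contributes one factor p.
factorial-below-square : ∀ {p} → Prime p → ∀ L → L < p * p →
  ∃[ t ] ∃[ r ] (L ! ≡ p ^ t * r × ¬ p ∣ r × t * p ≤ L)
factorial-below-square pr zero _ = 0 , 1 , refl , ¬prime-∣1 pr , z≤n
factorial-below-square {p} pr (suc L) 1+L<p²
  with factorial-below-square pr L (<-trans (n<1+n L) 1+L<p²) | p ∣? suc L
... | t , r , L!≡ , ¬p∣r , tp≤L | no ¬p∣1+L =
  t , suc L * r , trans (cong (suc L *_) L!≡) (swap (suc L) (p ^ t) r) ,
  prime-∤-* pr ¬p∣1+L ¬p∣r , m≤n⇒m≤1+n tp≤L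
  where swap : ∀ x y z → x * (y * z) ≡ y * (x * z)
        swap = solve-∀
... | t , r , L!≡ , ¬p∣r , tp≤L | yes (divides s 1+L≡sp) =
  suc t , s * r , eqn , prime-∤-* pr ¬p∣s ¬p∣r ,
  subst (suc t * p ≤_) (sym 1+L≡sp) (*-monoˡ-≤ p t<s)
  where
  instance _ = prime⇒nonZero pr
  t<s : t < s
  t<s = *-cancelʳ-< p t s (subst (t * p <_) 1+L≡sp (s≤s tp≤L))
  s<p : s < p
  s<p = *-cancelʳ-< p s p (subst (_< p * p) 1+L≡sp 1+L<p²)
  ¬p∣s : ¬ p ∣ s
  ¬p∣s p∣s = <⇒≱ s<p (∣⇒≤ {{>-nonZero (≤-trans (s≤s z≤n) t<s)}} p∣s)
  eqn : suc L ! ≡ p ^ suc t * (s * r)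
  eqn = trans (cong₂ _*_ 1+L≡sp L!≡) (regroup s p (p ^ t) r)
    where regroup : ∀ s p pt r → (s * p) * (pt * r) ≡ (p * pt) * (s * r)
          regroup = solve-∀

pow-∤-factorial : ∀ {p e L} → Prime p → e ≤ p → L < e * p → ¬ p ^ e ∣ L !
pow-∤-factorial {p} {e} {L} pr e≤p L<ep p^e∣L!
  with factorial-below-square pr L (<-≤-trans L<ep (*-monoˡ-≤ p e≤p))
... | t , r , L!≡ , ¬p∣r , tp≤L =
  pow-∤ pr ¬p∣r (*-cancelʳ-< p t e (≤-<-trans tp≤L L<ep)) (subst (p ^ e ∣_) L!≡ p^e∣L!)

prime-divisor : ∀ n → 2 ≤ n → ∃[ p ] (Prime p × p ∣ n)
prime-divisor n n≥2 = first-factor (factorise n {{>-nonZero (≤-trans (s≤s z≤n) n≥2)}})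
  where
  first-factor : PrimeFactorisation n → ∃[ p ] (Prime p × p ∣ n)
  first-factor record { factors = [] ; isFactorisation = n≡1 } =
    contradiction (≤-reflexive n≡1) (<⇒≱ n≥2)
  first-factor record { factors = p ∷ _ ; isFactorisation = n≡p*ps ; factorsPrime = pr ∷ _ } =
    p , pr , subst (p ∣_) (sym n≡p*ps) (m∣m*n _)

split-off : ∀ {q} → 2 ≤ q → ∀ n → 1 ≤ n → ∃[ e ] ∃[ r ] (n ≡ q ^ e * r × ¬ q ∣ r)
split-off {q} q≥2 n n≥1 = go n n≥1 (<-wellFounded n)
  where
  go : ∀ n → 1 ≤ n → Acc _<_ n → ∃[ e ] ∃[ r ] (n ≡ q ^ e * r × ¬ q ∣ r)
  go n n≥1 (acc smaller) with q ∣? n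
  ... | no ¬q∣n = 0 , n , sym (+-identityʳ n) , ¬q∣n
  ... | yes (divides zero n≡0) = contradiction (≤-reflexive n≡0) (<⇒≱ n≥1)
  ... | yes (divides c@(suc _) n≡cq) with go c (s≤s z≤n) (smaller c<n)
    where
    c<n : c < n
    c<n = subst (c <_) (sym n≡cq) (m<m*n c q q≥2)
  ... | e , r , c≡ , ¬q∣r =
    suc e , r , trans n≡cq (trans (cong (_* q) c≡) (regroup q (q ^ e) r)) , ¬q∣r
    where regroup : ∀ q qe r → (qe * r) * q ≡ (q * qe) * r
          regroup = solve-∀

coprime-pow-product : ∀ {r q X} → Coprime r q → ∀ e → q ^ e ∣ X → r ∣ X → q ^ e * r ∣ X
coprime-pow-product {r} {q} {X} cop e q^e∣X r∣X =
  subst (q ^ e * r ∣_) (sym X≡q^e*u) (*-monoʳ-∣ (q ^ e) (cancel e u (subst (r ∣_) X≡q^e*u r∣X)))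
  where
  u = quotient q^e∣X
  X≡q^e*u : X ≡ q ^ e * u
  X≡q^e*u = m∣n⇒n≡m*quotient q^e∣X
  cancel : ∀ e v → r ∣ q ^ e * v → r ∣ v
  cancel zero    v r∣ = subst (r ∣_) (+-identityʳ v) r∣
  cancel (suc e) v r∣ = cancel e v (coprime-divisor cop (subst (r ∣_) (*-assoc q (q ^ e) v) r∣))

-- Split n = q^e·r with q a prime divisor; r ∣ X by induction, q^e ∣ X by
-- hypothesis, and coprimality of r and q glues the two.
prime-powers⇒∣ : ∀ {X} n → 1 ≤ n → (∀ q a → Prime q → q ^ a ∣ n → q ^ a ∣ X) → n ∣ X
prime-powers⇒∣ {X} n n≥1 local = go n n≥1 local (<-wellFounded n)
  where
  go : ∀ n → 1 ≤ n → (∀ q a → Prime q → q ^ a ∣ n → q ^ a ∣ X) → Acc _<_ n → n ∣ X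
  go n n≥1 local (acc smaller) with n ≟ 1
  ... | yes refl = 1∣ X
  ... | no n≢1 with prime-divisor n (≤∧≢⇒< n≥1 (≢-sym n≢1))
  ... | q , pr , q∣n with split-off (prime≥2 pr) n n≥1
  ... | e , zero , n≡0 , _ = contradiction (≤-reflexive (trans n≡0 (*-zeroʳ (q ^ e)))) (<⇒≱ n≥1)
  ... | zero , r , n≡r , ¬q∣r = contradiction (subst (q ∣_) (trans n≡r (+-identityʳ r)) q∣n) ¬q∣r
  ... | e@(suc _) , r@(suc _) , n≡q^e*r , ¬q∣r =
    subst (_∣ X) (sym n≡q^e*r)
      (coprime-pow-product (coprime-sym (prime-coprime pr ¬q∣r)) e q^e∣X r∣X)
    where
    instance _ = prime⇒nonZero pr
    n≡r*q^e : n ≡ r * q ^ e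
    n≡r*q^e = trans n≡q^e*r (*-comm (q ^ e) r)
    r<n : r < n
    r<n = subst (r <_) (sym n≡r*q^e) (m<m*n r (q ^ e) (^-monoʳ-< q (prime≥2 pr) {0} {e} z<s))
    r∣n : r ∣ n
    r∣n = subst (r ∣_) (sym n≡r*q^e) (m∣m*n (q ^ e))
    r∣X : r ∣ X
    r∣X = go r (s≤s z≤n) (λ q′ a pr′ q′^a∣r → local q′ a pr′ (∣-trans q′^a∣r r∣n)) (smaller r<n)
    q^e∣X : q ^ e ∣ X
    q^e∣X = local q e pr (subst (q ^ e ∣_) (sym n≡q^e*r) (m∣m*n r))

valuation-exists : ∀ {q} → Prime q → ∀ n → 1 ≤ n → ∃[ e ] IsValuation q n e
valuation-exists {q} pr n n≥1 with split-off (prime≥2 pr) n n≥1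
... | e , r , n≡q^e*r , ¬q∣r =
  e , subst (q ^ e ∣_) (sym n≡q^e*r) (m∣m*n r) ,
  λ q^1+e∣n → pow-∤ {t = e} pr ¬q∣r ≤-refl (subst (q ^ suc e ∣_) n≡q^e*r q^1+e∣n)

valuation-bound : ∀ {q n a e} → q ^ a ∣ n → IsValuation q n e → a ≤ e
valuation-bound {q} q^a∣n (_ , q^1+e∤n) = ≮⇒≥ λ e<a → q^1+e∤n (∣-trans (^-∣-^ q e<a) q^a∣n)

linear<power : ∀ {q} → 3 ≤ q → ∀ a → suc (suc a) * q < q ^ suc (suc a)
linear<power {q} q≥3 zero = begin-strict
  2 * q       <⟨ *-monoˡ-< q {{>-nonZero (≤-trans (s≤s z≤n) q≥3)}} q≥3 ⟩
  q * q       ≡⟨ cong (q *_) (sym (*-identityʳ q)) ⟩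
  q * (q * 1) ∎
  where open ≤-Reasoning
linear<power {q} q≥3 (suc a) = begin-strict
  q + suc (suc a) * q   <⟨ +-monoʳ-< q (linear<power q≥3 a) ⟩
  q + Q                 ≤⟨ +-monoˡ-≤ Q (<⇒≤ (≤-<-trans (m≤m+n q (suc a * q)) (linear<power q≥3 a))) ⟩
  Q + Q                 ≡⟨ cong (Q +_) (sym (+-identityʳ Q)) ⟩
  2 * Q                 ≤⟨ *-monoˡ-≤ Q (≤-trans (s≤s (s≤s z≤n)) q≥3) ⟩
  q * Q                 ∎
  where
  open ≤-Reasoning
  Q = q ^ suc (suc a)

IsKempner : ℕ → ℕ → Set
IsKempner n s = n ∣ s ! × (∀ L → n ∣ L ! → s ≤ L)

kempner-exists : ∀ n → 1 ≤ n → ∃[ s ] IsKempner n s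
kempner-exists n@(suc m) _ = least (λ L → n ∣? L !) {n} (m∣m*n (m !))

kempner-criterion : ∀ {n s} → IsKempner n s → ∀ L → (n ∣ L ! ⇔ s ≤ L)
kempner-criterion (n∣s! , minimal) L = mk⇔ (minimal L) (λ s≤L → ∣-trans n∣s! (m≤n⇒m!∣n! s≤L))

kempner-≤ : ∀ {n s} → 1 ≤ n → IsKempner n s → s ≤ n
kempner-≤ {n@(suc m)} _ (_ , minimal) = minimal n (m∣m*n (m !))

kempner-prime : ∀ {p s} → Prime p → IsKempner p s → s ≡ p
kempner-prime {p} {s} pr kemp@(p∣s! , _) = ≤-antisym (kempner-≤ p≥1 kemp) (≮⇒≥ s≮p)
  where
  p≥1 : 1 ≤ p
  p≥1 = ≤-trans (s≤s z≤n) (prime≥2 pr)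
  -- otherwise p = p^1 would divide s! with s < 1·p
  s≮p : ¬ s < p
  s≮p s<p = pow-∤-factorial {e = 1} pr p≥1 (subst (s <_) (sym (*-identityˡ p)) s<p)
              (subst (_∣ s !) (sym (*-identityʳ p)) p∣s!)

-- In an odd non-prime n, every prime power q^a ∣ n has a·q ≤ n - 1:
-- for a = 1 because q is a proper divisor, for a ≥ 2 because q ≥ 3 gives
-- a·q < q^a ≤ n.
prime-power-bound : ∀ {n q a} → 1 ≤ n → ¬ 2 ∣ n → ¬ Prime n → Prime q → q ^ a ∣ n → a * q ≤ n ∸ 1
prime-power-bound {a = zero} _ _ _ _ _ = z≤n
prime-power-bound {suc n} {q} {a = 1} _ _ ¬prime[n] pr q*1∣n = subst (_≤ n) (sym (*-identityˡ q))
  (≤-pred (≤∧≢⇒< (∣⇒≤ (m*n∣⇒m∣ q 1 q*1∣n)) (λ q≡n → ¬prime[n] (subst Prime q≡n pr))))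
prime-power-bound {suc n} {q} {a = suc (suc a)} _ ¬2∣n _ pr q^a∣n =
  ≤-pred (<-≤-trans (linear<power q≥3 a) (∣⇒≤ q^a∣n))
  where
  q≥3 : 3 ≤ q
  q≥3 = ≤∧≢⇒< (prime≥2 pr) λ 2≡q → ¬2∣n (subst (_∣ suc n) (sym 2≡q) (m*n∣⇒m∣ q _ q^a∣n))

odd-nonprime-∣ : ∀ {n} → 1 ≤ n → ¬ 2 ∣ n → ¬ Prime n → n ∣ (n ∸ 1) !
odd-nonprime-∣ {n} n≥1 ¬2∣n ¬prime[n] = prime-powers⇒∣ n n≥1 λ q a pr q^a∣n →
  ∣-trans (pow-∣-factorial q {{prime⇒nonZero pr}} a)
          (m≤n⇒m!∣n! (prime-power-bound {a = a} n≥1 ¬2∣n ¬prime[n] pr q^a∣n))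

kempner-odd : ∀ {n s} → 1 ≤ n → ¬ 2 ∣ n → IsKempner n s → (s ≡ n ⇔ Prime n)
kempner-odd {n@(suc m)} {s} n≥1 ¬2∣n kemp@(_ , minimal) = mk⇔ s≡n⇒prime (λ pr → kempner-prime pr kemp)
  where
  s≡n⇒prime : s ≡ n → Prime n
  s≡n⇒prime s≡n with prime? n
  ... | yes prime[n] = prime[n]
  ... | no ¬prime[n] = contradiction (subst (_≤ m) s≡n (minimal m (odd-nonprime-∣ n≥1 ¬2∣n ¬prime[n])))
                         (<⇒≱ (n<1+n m))

-- S(n) ≤ max_p e_p·p, since each q^a ∣ n divides (a·q)!, which divides M!.
kempner-≤-max : ∀ {n s M} → 1 ≤ n → IsMaxEpP n M → IsKempner n s → s ≤ M
kempner-≤-max {n} {s} {M} n≥1 (bounded , _) (_ , minimal) = minimal M (prime-powers⇒∣ n n≥1 local)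
  where
  local : ∀ q a → Prime q → q ^ a ∣ n → q ^ a ∣ M !
  local q zero    _  _       = 1∣ _
  local q (suc a) pr q^a∣n with valuation-exists pr n n≥1
  ... | e , val = ∣-trans (pow-∣-factorial q {{prime⇒nonZero pr}} (suc a))
    (m≤n⇒m!∣n! (≤-trans (*-monoˡ-≤ q (valuation-bound {q} {n} {suc a} {e} q^a∣n val))
                        (bounded q e pr (m*n∣⇒m∣ q _ q^a∣n) val)))

-- If every exponent satisfies e_p ≤ p, then max_p e_p·p ≤ S(n): the prime
-- attaining the maximum has p^e ∤ L! for all L < e·p.
max-≤-kempner : ∀ {n s M} → (∀ p e → Prime p → p ∣ n → IsValuation p n e → e ≤ p) →
  IsMaxEpP n M → IsKempner n s → M ≤ s
max-≤-kempner _ (_ , inj₁ refl) _ = z≤n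
max-≤-kempner {s = s} small (_ , inj₂ (p , e , pr , p∣n , val , refl)) (n∣s! , _) =
  ≮⇒≥ λ s<ep → pow-∤-factorial pr (small p e pr p∣n val) s<ep (∣-trans (proj₁ val) n∣s!)

kempner-shifted : ∀ {n s k} → IsKempner n s → n ≤ k → (n ∣ (k ∸ n) ! ⇔ n + s ≤ k)
kempner-shifted {n} {s} {k} kemp n≤k = ⇔-trans (kempner-criterion kemp (k ∸ n)) (mk⇔
  (λ s≤k-n → subst (n + s ≤_) (m+[n∸m]≡n n≤k) (+-monoʳ-≤ n s≤k-n))
  (λ n+s≤k → subst (_≤ k ∸ n) (m+n∸m≡n n s) (∸-monoˡ-≤ n n+s≤k)))

mu-criterion : ∀ {n s k} → IsKempner n s → n ≤ k → (n ! * n ∣ k ! ⇔ n + s ≤ k)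
mu-criterion {n} {s} {k} kemp n≤k = ⇔-trans
  (subst (λ x → (n ! * n ∣ x !) ⇔ (n ∣ (k ∸ n) !)) (m+[n∸m]≡n n≤k) (reduction₁ n (k ∸ n)))
  (kempner-shifted kemp n≤k)

double-criterion : ∀ {n s k} → ¬ 2 ∣ n → IsKempner n s → n ≤ k → (n ! * n ∣ 2 * k ! ⇔ n + s ≤ k)
double-criterion {n} {s} {k} ¬2∣n kemp n≤k = ⇔-trans
  (subst (λ x → (n ! * n ∣ 2 * x !) ⇔ (n ∣ 2 * (k ∸ n) !)) (m+[n∸m]≡n n≤k) (reduction 2 n (k ∸ n)))
  (⇔-trans (mk⇔ (odd-cancel ¬2∣n) (∣n⇒∣m*n 2)) (kempner-shifted kemp n≤k))

mu-least : ∀ {n s} → IsKempner n s →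
  n ≤ n + s × n ! * n ∣ (n + s) ! × (∀ k → n ≤ k → k < n + s → ¬ (n ! * n ∣ k !))
mu-least {n} {s} kemp =
  m≤m+n n s ,
  Equivalence.from (mu-criterion kemp (m≤m+n n s)) ≤-refl ,
  λ k n≤k k<n+s D∣k! → <⇒≱ k<n+s (Equivalence.to (mu-criterion kemp n≤k) D∣k!)

mu-≤-double : ∀ {n s} → 1 ≤ n → ¬ 2 ∣ n → IsKempner n s → n + s ≤ n + n × (n + s ≡ n + n ⇔ Prime n)
mu-≤-double {n} {s} n≥1 ¬2∣n kemp =
  +-monoʳ-≤ n (kempner-≤ n≥1 kemp) ,
  ⇔-trans (mk⇔ (+-cancelˡ-≡ n s n) (cong (n +_))) (kempner-odd n≥1 ¬2∣n kemp)

odd-suc : ∀ j' → odd (suc j') ≡ suc (2 * j')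
odd-suc j' = +-suc j' (j' + 0)

odd-positive : ∀ {j} → 1 ≤ j → 1 ≤ odd j
odd-positive {suc j'} _ = subst (1 ≤_) (sym (odd-suc j')) (s≤s z≤n)

odd-is-odd : ∀ {j} → 1 ≤ j → ¬ 2 ∣ odd j
odd-is-odd {suc j'} _ 2∣odd = ¬prime-∣1 prime[2]
  (∣m+n∣m⇒∣n (subst (2 ∣_) (trans (odd-suc j') (+-comm 1 (2 * j'))) 2∣odd) (m∣m*n j'))

four-j : ∀ {j} → 1 ≤ j → 4 * j ∸ 2 ≡ odd j + odd j
four-j {suc j'} _ = trans (cong (_∸ 2) (expand j')) (sym (cong₂ _+_ (odd-suc j') (odd-suc j')))
  where expand : ∀ j' → 4 * suc j' ≡ 2 + (suc (2 * j') + suc (2 * j'))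
        expand = solve-∀

proposition1 : (j : ℕ) → 1 ≤ j →
    ∃[ m ] (IsMu j m
      × (m ≤ 4 * j ∸ 2 × (m ≡ 4 * j ∸ 2 ⇔ Prime (odd j)))
      × (∀ k → odd j ≤ k → (AIsInteger k j ⇔ m ≤ k))
      × ((∀ p e → Prime p → p ∣ odd j → IsValuation p (odd j) e → e ≤ p) →
         ∀ M → IsMaxEpP (odd j) M → m ≡ odd j + M))
proposition1 j j≥1 with kempner-exists (odd j) (odd-positive j≥1)
... | s , kemp =
  n + s ,
  mu-least kemp ,
  subst (λ x → n + s ≤ x × (n + s ≡ x ⇔ Prime n)) (sym (four-j j≥1))
        (mu-≤-double (odd-positive j≥1) (odd-is-odd j≥1) kemp) ,
  (λ k → double-criterion {k = k} (odd-is-odd j≥1) kemp) ,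
  λ small M max → cong (n +_) (≤-antisym (kempner-≤-max (odd-positive j≥1) max kemp)
                                          (max-≤-kempner small max kemp))
  where n = odd j
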